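{- Let $\Sigma$ be a compact real 2-manifold without boundary, let $l\le 2$, and let $G$ be a $(2,l)$-sparse $\Sigma$-graph with a quadrilateral face $Q$ whose (possibly degenerate) boundary walk is $v_1,e_1,v_2,e_2,v_3,e_3,v_4,e_4,v_1$, where $v_1\neq v_3$ and $e_1\neq e_3$. Suppose $G_{Q,v_1,v_3}$ is not $(2,l)$-sparse. Then at least one of the following holds: (1) there is a subgraph $H$ of $G$ with $v_1,v_3\in H$, exactly one of $v_2,v_4$ in $H$, and $\gamma(H)=l$; (2) there is a subgraph $K$ of $G$ with $v_1,v_3\in K$, $v_2,v_4\notin K$, and $\gamma(K)=l+1$.
   Context: Graphs are finite undirected multigraphs (loops and parallel edges allowed). A $\Sigma$-graph is a pair $(\Gamma,\varphi)$ with $\varphi:|\Gamma|\to\Sigma$ a continuous embedding of the geometric realisation of $\Gamma$. Faces are connected components of the complement of the image; a cellular face is one homeomorphic to $\mathbb R^2$, its degree being the edge length of its unique boundary walk; a quadrilateral is a cellular face of degree 4. For a graph $H$, $\gamma(H)=2|V(H)|-|E(H)|$; for $l\le 2$, $H$ is $(2,l)$-sparse if $\gamma(H')\ge l$ for every nonempty subgraph $H'$. Quadrilateral contraction: add a new edge $d$ joining $v_1$ and $v_3$ embedded as a diagonal inside $Q$, collapse $d$ to a point, and delete $e_1$ and $e_3$; the result is $G_{Q,v_1,v_3}=(G\cup\{d\})/d-\{e_1,e_3\}$ (its underlying graph is obtained by identifying $v_1,v_3$ and deleting $e_1,e_3$). -}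

module Defs where

open import Data.Nat using (ℕ; suc)
open import Data.Fin using (Fin; punchIn; punchOut; _≟_)
open import Data.Fin.Subset using (Subset; _∈_; _∉_; ∣_∣; Nonempty)
open import Data.Product using (_×_; _,_; proj₁; proj₂; ∃-syntax)
open import Data.Sum using (_⊎_)
open import Data.Integer using (ℤ; +_; _-_; _≤_)
open import Relation.Binary.PropositionalEquality using (_≡_; _≢_; sym)
open import Relation.Nullary using (yes; no)

-- A finite undirected multigraph (loops and parallel edges allowed) with
-- vertex set Fin n and edge set Fin m; each edge has an (unordered) pair of
-- endpoints, recorded as an ordered pair whose order is irrelevant.
record Graph (n m : ℕ) : Set where
  field
    ends : Fin m → Fin n × Fin n
open Graph public

Joins : ∀ {n m} → Graph n m → Fin m → Fin n → Fin n → Set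
Joins G e x y = ends G e ≡ (x , y) ⊎ ends G e ≡ (y , x)

record Subgraph {n m : ℕ} (G : Graph n m) : Set where
  field
    VS     : Subset n
    ES     : Subset m
    closed : ∀ e → e ∈ ES → (proj₁ (ends G e) ∈ VS) × (proj₂ (ends G e) ∈ VS)
open Subgraph public

γ : ∀ {n m} {G : Graph n m} → Subgraph G → ℤ
γ H = + (2 Data.Nat.* ∣ VS H ∣) - + ∣ ES H ∣
  where import Data.Nat

Sparse : ℤ → ∀ {n m} → Graph n m → Set
Sparse l G = ∀ (H : Subgraph G) → Nonempty (VS H) → l ≤ γ H

deleteEdge : ∀ {n m} → Graph n (suc m) → Fin (suc m) → Graph n m
deleteEdge G e = record { ends = λ i → ends G (punchIn e i) }

mergeV : ∀ {n} (a b : Fin (suc n)) → a ≢ b → Fin (suc n) → Fin n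
mergeV a b a≢b v with b ≟ v
... | yes _   = punchOut {i = b} {j = a} (λ eq → a≢b (sym eq))
... | no b≢v  = punchOut {i = b} {j = v} b≢v

identify : ∀ {n m} → Graph (suc n) m → (a b : Fin (suc n)) → a ≢ b → Graph n m
identify G a b a≢b = record { ends = λ i → mergeV a b a≢b (proj₁ (ends G i))
                                         , mergeV a b a≢b (proj₂ (ends G i)) }

-- underlying graph of the quadrilateral contraction G_{Q,v1,v3}:
-- identify v1 and v3, delete e1 and e3
quadContract : ∀ {n k} → Graph (suc n) (suc (suc k)) →
               (v1 v3 : Fin (suc n)) → v1 ≢ v3 →
               (e1 e3 : Fin (suc (suc k))) → e1 ≢ e3 → Graph n k
quadContract G v1 v3 v≢ e1 e3 e≢ =
  deleteEdge (deleteEdge (identify G v1 v3 v≢) e1) (punchOut {i = e1} {j = e3} e≢)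

{-# OPTIONS --safe #-}
module Submission where

-- A subgraph H′ of the contraction with γ H′ < l pulls back to a subgraph H of G by splitting
-- the merged vertex into v1 and v3 again and keeping the same edges, so neither e1 nor e3 is in H.
-- If H′ misses the merged vertex, γ H = γ H′ < l contradicts the sparsity of G; otherwise
-- γ H = γ H′ + 2 ≤ l + 1. If exactly one of v2, v4 lies in H, adding the edge e1 or e3 joining it
-- to v1 or v3 gives γ = l by sparsity; if both do, adding both edges would give γ < l. If neither
-- does, γ H is l + 1, or it is l and removing an edge of H gives l + 1 (H has an edge, as the
-- two vertices v1, v3 alone have γ = 4 > l). Since subgraphs can be enumerated, sparsity is
-- decidable, which turns the hypothesis ¬ Sparse into such an H′.

open import Defs
open import Data.Nat using (ℕ; suc)
open import Data.Fin using (Fin)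
open import Data.Fin.Subset using (_∈_; _∉_)
open import Data.Product using (_×_; ∃-syntax)
open import Data.Sum using (_⊎_)
open import Data.Integer using (ℤ; +_; _+_; _≤_)
open import Relation.Binary.PropositionalEquality using (_≡_; _≢_)
open import Relation.Nullary using (¬_)

import Data.Nat as ℕ
import Data.Nat.Properties as ℕ
open import Data.Fin using (zero; suc; punchIn; punchOut; _≟_)
open import Data.Fin.Properties using (all?; punchIn-punchOut; punchOut-cong)
open import Data.Fin.Subset using (Subset; inside; outside; ⁅_⁆; _∪_; _─_; ∣_∣; Nonempty; Empty)
open import Data.Fin.Subset.Properties
  using (_∈?_; nonempty?; anySubset?; ∪-identityˡ; p─⊥≡p; p─q⊆p; x∈p∪q⁻; x∈⁅y⁆⇒x≡y;
         x∈p∧x≢y⇒x∈p-y; Empty-unique; ∣⊥∣≡0)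
open import Data.Vec using (_∷_; lookup; insertAt; here; there)
open import Data.Vec.Properties using ([]=⇒lookup; lookup⇒[]=; insertAt-lookup; insertAt-punchIn)
open import Data.Product using (_,_; proj₁; proj₂; ∃)
import Data.Product as Product
open import Data.Sum using (inj₁; inj₂)
open import Data.Integer using (_-_; _<_; _<?_; -1ℤ; +≤+) renaming (_≟_ to _≟ℤ_)
open import Data.Integer.Properties
  using (≤-antisym; ≤-trans; ≤-reflexive; <⇒≱; ≮⇒≥; ≤∧≢⇒<; +-monoˡ-≤; +-comm; +-assoc;
         +-identityʳ; i<j⇒suc[i]≤j; suc[i]≤j⇒i<j)
open import Data.Integer.Tactic.RingSolver using (solve-∀)
open import Function using (_∘_)
open import Relation.Binary.PropositionalEquality
  using (refl; sym; trans; cong; subst; subst₂; module ≡-Reasoning)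
open import Relation.Nullary using (Dec; yes; no; contradiction)
open import Relation.Nullary.Decidable using (_×-dec_; _→-dec_; map′; decidable-stable)

∣insertAt∣≡∣∷∣ : ∀ {n} (p : Subset n) i b → ∣ insertAt p i b ∣ ≡ ∣ b ∷ p ∣
∣insertAt∣≡∣∷∣ p               zero    b       = refl
∣insertAt∣≡∣∷∣ (inside  ∷ p)  (suc i) inside  = cong suc (∣insertAt∣≡∣∷∣ p i inside)
∣insertAt∣≡∣∷∣ (inside  ∷ p)  (suc i) outside = cong suc (∣insertAt∣≡∣∷∣ p i outside)
∣insertAt∣≡∣∷∣ (outside ∷ p)  (suc i) inside  = ∣insertAt∣≡∣∷∣ p i inside
∣insertAt∣≡∣∷∣ (outside ∷ p)  (suc i) outside = ∣insertAt∣≡∣∷∣ p i outside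

x∉p⇒∣⁅x⁆∪p∣≡1+∣p∣ : ∀ {n} {x : Fin n} {p} → x ∉ p → ∣ ⁅ x ⁆ ∪ p ∣ ≡ suc ∣ p ∣
x∉p⇒∣⁅x⁆∪p∣≡1+∣p∣ {x = zero}  {inside  ∷ p} x∉p = contradiction here x∉p
x∉p⇒∣⁅x⁆∪p∣≡1+∣p∣ {x = zero}  {outside ∷ p} x∉p = cong (suc ∘ ∣_∣) (∪-identityˡ p)
x∉p⇒∣⁅x⁆∪p∣≡1+∣p∣ {x = suc x} {inside  ∷ p} x∉p = cong suc (x∉p⇒∣⁅x⁆∪p∣≡1+∣p∣ (x∉p ∘ there))
x∉p⇒∣⁅x⁆∪p∣≡1+∣p∣ {x = suc x} {outside ∷ p} x∉p = x∉p⇒∣⁅x⁆∪p∣≡1+∣p∣ (x∉p ∘ there)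

x∈p⇒∣p∣≡1+∣p─⁅x⁆∣ : ∀ {n} {x : Fin n} {p} → x ∈ p → ∣ p ∣ ≡ suc ∣ p ─ ⁅ x ⁆ ∣
x∈p⇒∣p∣≡1+∣p─⁅x⁆∣ {p = inside ∷ p}  here            = cong (suc ∘ ∣_∣) (sym (p─⊥≡p p))
x∈p⇒∣p∣≡1+∣p─⁅x⁆∣ {p = inside ∷ p}  (there x∈p) = cong suc (x∈p⇒∣p∣≡1+∣p─⁅x⁆∣ x∈p)
x∈p⇒∣p∣≡1+∣p─⁅x⁆∣ {p = outside ∷ p} (there x∈p) = x∈p⇒∣p∣≡1+∣p─⁅x⁆∣ x∈p

x∈p∧y∈p∧x≢y⇒2≤∣p∣ : ∀ {n} {x y : Fin n} {p} → x ∈ p → y ∈ p → x ≢ y → 2 ℕ.≤ ∣ p ∣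
x∈p∧y∈p∧x≢y⇒2≤∣p∣ x∈p y∈p x≢y
  rewrite x∈p⇒∣p∣≡1+∣p─⁅x⁆∣ x∈p | x∈p⇒∣p∣≡1+∣p─⁅x⁆∣ (x∈p∧x≢y⇒x∈p-y y∈p (x≢y ∘ sym))
  = ℕ.s≤s (ℕ.s≤s ℕ.z≤n)

x∉p⇒lookup≡outside : ∀ {n} {x : Fin n} {p} → x ∉ p → lookup p x ≡ outside
x∉p⇒lookup≡outside {x = x} {p} x∉p with lookup p x in eq
... | inside  = contradiction (lookup⇒[]= x p eq) x∉p
... | outside = refl

insertAt-outside-∉ : ∀ {n} (p : Subset n) i → i ∉ insertAt p i outside
insertAt-outside-∉ p       zero    ()
insertAt-outside-∉ (_ ∷ p) (suc i) (there i∈) = insertAt-outside-∉ p i i∈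

∈-insertAt-outside⁻ : ∀ {n} {x} {p : Subset n} i →
                      x ∈ insertAt p i outside → ∃[ j ] (x ≡ punchIn i j × j ∈ p)
∈-insertAt-outside⁻             zero    (there x∈) = _ , refl , x∈
∈-insertAt-outside⁻ {p = _ ∷ p} (suc i) here       = zero , refl , here
∈-insertAt-outside⁻ {p = _ ∷ p} (suc i) (there x∈) with ∈-insertAt-outside⁻ i x∈
... | j , refl , j∈ = suc j , refl , there j∈

punchIn-∈-insertAt⁺ : ∀ {n} {j} {p : Subset n} i b → j ∈ p → punchIn i j ∈ insertAt p i b
punchIn-∈-insertAt⁺ {j = j} {p} i b j∈ =
  lookup⇒[]= _ _ (trans (insertAt-punchIn p i b j) ([]=⇒lookup j∈))

punchIn-∈-insertAt⁻ : ∀ {n} {j} {p : Subset n} i b → punchIn i j ∈ insertAt p i b → j ∈ p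
punchIn-∈-insertAt⁻ {j = j} {p} i b j∈ =
  lookup⇒[]= _ _ (trans (sym (insertAt-punchIn p i b j)) ([]=⇒lookup j∈))

<⇒+1≤ : ∀ {i j} → i < j → i + + 1 ≤ j
<⇒+1≤ {i} i<j = subst (_≤ _) (+-comm (+ 1) i) (i<j⇒suc[i]≤j i<j)

+1≤⇒< : ∀ {i j} → i + + 1 ≤ j → i < j
+1≤⇒< {i} i+1≤j = suc[i]≤j⇒i<j (subst (_≤ _) (+-comm i (+ 1)) i+1≤j)

+1-cancel-≤ : ∀ {i j} → i + + 1 ≤ j + + 1 → i ≤ j
+1-cancel-≤ {i} {j} h = subst₂ _≤_ (undo i) (undo j) (+-monoˡ-≤ -1ℤ h)
  where
  undo : ∀ k → k + + 1 + -1ℤ ≡ k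
  undo k = trans (+-assoc k (+ 1) -1ℤ) (+-identityʳ k)

≤∧≤+1⇒≡∨≡+1 : ∀ {i j} → i ≤ j → j ≤ i + + 1 → j ≡ i ⊎ j ≡ i + + 1
≤∧≤+1⇒≡∨≡+1 {i} {j} i≤j j≤i+1 with j ≟ℤ i + + 1
... | yes j≡i+1 = inj₂ j≡i+1
... | no  j≢i+1 = inj₁ (≤-antisym (+1-cancel-≤ (<⇒+1≤ (≤∧≢⇒< j≤i+1 j≢i+1))) i≤j)

γ-counts : (vertices edges : ℕ) → ℤ
γ-counts v e = + (2 ℕ.* v) - + e

γ-counts-suc-edges : ∀ v e → γ-counts v e ≡ γ-counts v (suc e) + + 1
γ-counts-suc-edges v e = sym (identity (+ (2 ℕ.* v)) (+ e))
  where
  identity : ∀ (i j : ℤ) → i - (+ 1 + j) + + 1 ≡ i - j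
  identity = solve-∀

γ-counts-suc-vertices : ∀ v e → γ-counts (suc v) e ≡ γ-counts v e + + 1 + + 1
γ-counts-suc-vertices v e =
  trans (cong (λ w → + w - + e) (ℕ.*-suc 2 v)) (identity (+ (2 ℕ.* v)) (+ e))
  where
  identity : ∀ (i j : ℤ) → + 2 + i - j ≡ i - j + + 1 + + 1
  identity = solve-∀

EndsIn : ∀ {n m} → Graph n m → Subset n → Fin m → Set
EndsIn G V e = proj₁ (ends G e) ∈ V × proj₂ (ends G e) ∈ V

joins⇒EndsIn : ∀ {n m} (G : Graph n m) e {x y V} → Joins G e x y → x ∈ V → y ∈ V → EndsIn G V e
joins⇒EndsIn G e (inj₁ ends≡) x∈ y∈ rewrite ends≡ = x∈ , y∈
joins⇒EndsIn G e (inj₂ ends≡) x∈ y∈ rewrite ends≡ = y∈ , x∈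

module _ {n m} {G : Graph n m} where

  addEdge : (H : Subgraph G) (e : Fin m) → EndsIn G (VS H) e → Subgraph G
  addEdge H e e-in = record { VS = VS H ; ES = ⁅ e ⁆ ∪ ES H ; closed = closed′ }
    where
    closed′ : ∀ f → f ∈ ⁅ e ⁆ ∪ ES H → EndsIn G (VS H) f
    closed′ f f∈ with x∈p∪q⁻ ⁅ e ⁆ (ES H) f∈
    ... | inj₁ f∈⁅e⁆ rewrite x∈⁅y⁆⇒x≡y e f∈⁅e⁆ = e-in
    ... | inj₂ f∈ES  = closed H f f∈ES

  removeEdge : Subgraph G → Fin m → Subgraph G
  removeEdge H f = record
    { VS = VS H ; ES = ES H ─ ⁅ f ⁆ ; closed = λ e e∈ → closed H e (p─q⊆p (ES H) ⁅ f ⁆ e∈) }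

  addEdge-∉ : ∀ (H : Subgraph G) {e f} (e-in : EndsIn G (VS H) e) →
              f ≢ e → f ∉ ES H → f ∉ ES (addEdge H e e-in)
  addEdge-∉ H {e} _ f≢e f∉ f∈ with x∈p∪q⁻ ⁅ e ⁆ (ES H) f∈
  ... | inj₁ f∈⁅e⁆ = f≢e (x∈⁅y⁆⇒x≡y e f∈⁅e⁆)
  ... | inj₂ f∈ES  = f∉ f∈ES

  γ-addEdge : ∀ (H : Subgraph G) {e} (e-in : EndsIn G (VS H) e) →
              e ∉ ES H → γ H ≡ γ (addEdge H e e-in) + + 1
  γ-addEdge H _ e∉ =
    trans (γ-counts-suc-edges ∣ VS H ∣ ∣ ES H ∣)
          (cong (λ c → γ-counts ∣ VS H ∣ c + + 1) (sym (x∉p⇒∣⁅x⁆∪p∣≡1+∣p∣ e∉)))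

  γ-removeEdge : ∀ (H : Subgraph G) {f} → f ∈ ES H → γ (removeEdge H f) ≡ γ H + + 1
  γ-removeEdge H {f} f∈ =
    trans (γ-counts-suc-edges ∣ VS H ∣ ∣ ES H ─ ⁅ f ⁆ ∣)
          (cong (λ c → γ-counts ∣ VS H ∣ c + + 1) (sym (x∈p⇒∣p∣≡1+∣p─⁅x⁆∣ f∈)))

  4≤γ-edgeless : ∀ (H : Subgraph G) {x y} → Empty (ES H) → x ∈ VS H → y ∈ VS H → x ≢ y → + 4 ≤ γ H
  4≤γ-edgeless H ∅ x∈ y∈ x≢y = subst (+ 4 ≤_) (cong (γ-counts ∣ VS H ∣) no-edges) 4≤γ-counts
    where
    no-edges : 0 ≡ ∣ ES H ∣
    no-edges = sym (trans (cong ∣_∣ (Empty-unique ∅)) (∣⊥∣≡0 m))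
    4≤γ-counts : + 4 ≤ γ-counts ∣ VS H ∣ 0
    4≤γ-counts = +≤+ (ℕ.≤-trans (ℕ.*-monoʳ-≤ 2 (x∈p∧y∈p∧x≢y⇒2≤∣p∣ x∈ y∈ x≢y)) (ℕ.m≤m+n _ 0))

  ∃-subgraph? : (P : Subset n → Subset m → Set) → (∀ V E → Dec (P V E)) →
                Dec (∃[ H ] P (VS H) (ES H))
  ∃-subgraph? P P? =
    map′ (λ (V , E , cl , p) → record { VS = V ; ES = E ; closed = cl } , p)
         (λ (H , p) → VS H , ES H , closed H , p)
         (anySubset? λ V → anySubset? λ E → closed? V E ×-dec P? V E)
    where
    closed? : ∀ V E → Dec (∀ e → e ∈ E → EndsIn G V e)
    closed? V E = all? λ e → e ∈? E →-dec (proj₁ (ends G e) ∈? V ×-dec proj₂ (ends G e) ∈? V)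

¬Sparse⇒violation : ∀ {l n m} {G : Graph n m} → ¬ Sparse l G → ∃[ H ] (Nonempty (VS H) × γ H < l)
¬Sparse⇒violation {l} ¬sparse = decidable-stable
  (∃-subgraph? (λ V E → Nonempty V × γ-counts ∣ V ∣ ∣ E ∣ < l)
               (λ V E → nonempty? V ×-dec γ-counts ∣ V ∣ ∣ E ∣ <? l))
  (λ ∄ → ¬sparse λ H ne → ≮⇒≥ λ γ<l → ∄ (H , ne , γ<l))

module _ {l n m} {G : Graph n m} (sparse : Sparse l G) where

  γ-addEdge≡l : ∀ (H : Subgraph G) {e} (e-in : EndsIn G (VS H) e) →
                Nonempty (VS H) → e ∉ ES H → γ H ≤ l + + 1 → γ (addEdge H e e-in) ≡ l
  γ-addEdge≡l H {e} e-in ne e∉ γ≤ =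
    ≤-antisym (+1-cancel-≤ (subst (_≤ l + + 1) (γ-addEdge H e-in e∉) γ≤))
              (sparse (addEdge H e e-in) ne)

  γ≡l⇒¬∉ : ∀ (H : Subgraph G) {e} (e-in : EndsIn G (VS H) e) →
           Nonempty (VS H) → γ H ≡ l → ¬ e ∉ ES H
  γ≡l⇒¬∉ H {e} e-in ne γ≡l e∉ =
    <⇒≱ (+1≤⇒< (≤-reflexive (trans (sym (γ-addEdge H e-in e∉)) γ≡l))) (sparse (addEdge H e e-in) ne)

module LiftDelete {n m} (G : Graph n (suc m)) (d : Fin (suc m)) where

  liftDelete : Subgraph (deleteEdge G d) → Subgraph G
  liftDelete H = record { VS = VS H ; ES = insertAt (ES H) d outside ; closed = closed′ }
    where
    closed′ : ∀ e → e ∈ insertAt (ES H) d outside → EndsIn G (VS H) e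
    closed′ e e∈ with ∈-insertAt-outside⁻ d e∈
    ... | j , refl , j∈ = closed H j j∈

  γ-liftDelete : ∀ H → γ (liftDelete H) ≡ γ H
  γ-liftDelete H = cong (γ-counts ∣ VS H ∣) (∣insertAt∣≡∣∷∣ (ES H) d outside)

  deleted-∉-liftDelete : ∀ H → d ∉ ES (liftDelete H)
  deleted-∉-liftDelete H = insertAt-outside-∉ (ES H) d

  punchIn-∉-liftDelete : ∀ H {j} → j ∉ ES H → punchIn d j ∉ ES (liftDelete H)
  punchIn-∉-liftDelete H j∉ = j∉ ∘ punchIn-∈-insertAt⁻ d outside

module LiftIdentify {n m} (G : Graph (suc n) m) (a b : Fin (suc n)) (a≢b : a ≢ b) where

  merged : Fin n
  merged = punchOut {i = b} {j = a} (a≢b ∘ sym)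

  mergeV-a : mergeV a b a≢b a ≡ merged
  mergeV-a with b ≟ a
  ... | yes b≡a = contradiction (sym b≡a) a≢b
  ... | no  _   = punchOut-cong b refl

  mergeV-b : mergeV a b a≢b b ≡ merged
  mergeV-b with b ≟ b
  ... | yes _   = refl
  ... | no  b≢b = contradiction refl b≢b

  preimage : Subset n → Subset (suc n)
  preimage S = insertAt S b (lookup S merged)

  lookup-preimage : ∀ S v → lookup (preimage S) v ≡ lookup S (mergeV a b a≢b v)
  lookup-preimage S v with b ≟ v
  ... | yes refl = insertAt-lookup S b (lookup S merged)
  ... | no  b≢v  = begin
    lookup (preimage S) v                          ≡⟨ cong (lookup (preimage S)) (punchIn-punchOut b≢v) ⟨
    lookup (preimage S) (punchIn b (punchOut b≢v)) ≡⟨ insertAt-punchIn S b _ (punchOut b≢v) ⟩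
    lookup S (punchOut b≢v)                        ∎
    where open ≡-Reasoning

  ∈-preimage⁺ : ∀ {S v} → mergeV a b a≢b v ∈ S → v ∈ preimage S
  ∈-preimage⁺ {S} {v} v∈ = lookup⇒[]= v (preimage S) (trans (lookup-preimage S v) ([]=⇒lookup v∈))

  liftIdentify : Subgraph (identify G a b a≢b) → Subgraph G
  liftIdentify H = record
    { VS     = preimage (VS H)
    ; ES     = ES H
    ; closed = λ e e∈ → Product.map ∈-preimage⁺ ∈-preimage⁺ (closed H e e∈)
    }

  a∈liftIdentify : ∀ H → merged ∈ VS H → a ∈ VS (liftIdentify H)
  a∈liftIdentify H m∈ = ∈-preimage⁺ (subst (_∈ VS H) (sym mergeV-a) m∈)

  b∈liftIdentify : ∀ H → merged ∈ VS H → b ∈ VS (liftIdentify H)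
  b∈liftIdentify H m∈ = ∈-preimage⁺ (subst (_∈ VS H) (sym mergeV-b) m∈)

  liftIdentify-nonempty : ∀ H → Nonempty (VS H) → Nonempty (VS (liftIdentify H))
  liftIdentify-nonempty H (j , j∈) = punchIn b j , punchIn-∈-insertAt⁺ b _ j∈

  ∣preimage∣ : ∀ S → ∣ preimage S ∣ ≡ ∣ lookup S merged ∷ S ∣
  ∣preimage∣ S = ∣insertAt∣≡∣∷∣ S b (lookup S merged)

  γ-liftIdentify-∈ : ∀ H → merged ∈ VS H → γ (liftIdentify H) ≡ γ H + + 1 + + 1
  γ-liftIdentify-∈ H m∈ = begin
    γ-counts (∣ preimage (VS H) ∣) E             ≡⟨ cong (λ c → γ-counts c E) (∣preimage∣ (VS H)) ⟩
    γ-counts (∣ lookup (VS H) merged ∷ VS H ∣) E ≡⟨ cong (λ s → γ-counts (∣ s ∷ VS H ∣) E)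
                                                         ([]=⇒lookup m∈) ⟩
    γ-counts (suc ∣ VS H ∣) E                    ≡⟨ γ-counts-suc-vertices ∣ VS H ∣ E ⟩
    γ H + + 1 + + 1                              ∎
    where
    open ≡-Reasoning
    E = ∣ ES H ∣

  γ-liftIdentify-∉ : ∀ H → merged ∉ VS H → γ (liftIdentify H) ≡ γ H
  γ-liftIdentify-∉ H m∉ = cong (λ c → γ-counts c ∣ ES H ∣)
    (trans (∣preimage∣ (VS H)) (cong (λ s → ∣ s ∷ VS H ∣) (x∉p⇒lookup≡outside m∉)))

module Quadrilateral {l n k} {G : Graph (suc n) (suc (suc k))} (sparse : Sparse l G)
  {v1 v2 v3 v4 : Fin (suc n)} {e1 e3 : Fin (suc (suc k))}
  (e1-joins : Joins G e1 v1 v2) (e3-joins : Joins G e3 v3 v4)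
  (v1≢v3 : v1 ≢ v3) (e1≢e3 : e1 ≢ e3) where

  Tight : Subgraph G → Set
  Tight H = v1 ∈ VS H × v3 ∈ VS H × e1 ∉ ES H × e3 ∉ ES H × γ H ≤ l + + 1

  Alternative₁ : Subgraph G → Set
  Alternative₁ H = v1 ∈ VS H × v3 ∈ VS H
                 × ((v2 ∈ VS H × v4 ∉ VS H) ⊎ (v2 ∉ VS H × v4 ∈ VS H)) × γ H ≡ l

  Alternative₂ : Subgraph G → Set
  Alternative₂ K = v1 ∈ VS K × v3 ∈ VS K × v2 ∉ VS K × v4 ∉ VS K × γ K ≡ l + + 1

  e1-in : ∀ {V} → v1 ∈ V → v2 ∈ V → EndsIn G V e1
  e1-in = joins⇒EndsIn G e1 e1-joins

  e3-in : ∀ {V} → v3 ∈ V → v4 ∈ V → EndsIn G V e3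
  e3-in = joins⇒EndsIn G e3 e3-joins

  tight⇒alternative₂ : l ≤ + 2 → ∀ H → Tight H → v2 ∉ VS H → v4 ∉ VS H → ∃ Alternative₂
  tight⇒alternative₂ l≤2 H (v1∈ , v3∈ , _ , _ , γ≤) v2∉ v4∉
    with ≤∧≤+1⇒≡∨≡+1 (sparse H (v1 , v1∈)) γ≤
  ... | inj₂ γ≡l+1 = H , v1∈ , v3∈ , v2∉ , v4∉ , γ≡l+1
  ... | inj₁ γ≡l with nonempty? (ES H)
  ...   | yes (f , f∈) = removeEdge H f , v1∈ , v3∈ , v2∉ , v4∉ ,
                         trans (γ-removeEdge H f∈) (cong (_+ + 1) γ≡l)
  ...   | no  ∅        = contradiction (≤-trans (4≤γ-edgeless H ∅ v1∈ v3∈ v1≢v3) γ≤2)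
                                       λ { (+≤+ (ℕ.s≤s (ℕ.s≤s ()))) }
    where
    γ≤2 : γ H ≤ + 2
    γ≤2 = subst (_≤ + 2) (sym γ≡l) l≤2

  tight⇒conclusion : l ≤ + 2 → ∀ H → Tight H → ∃ Alternative₁ ⊎ ∃ Alternative₂
  tight⇒conclusion l≤2 H tight@(v1∈ , v3∈ , e1∉ , e3∉ , γ≤) with v2 ∈? VS H | v4 ∈? VS H
  ... | yes v2∈ | no v4∉ = inj₁ (addEdge H e1 (e1-in v1∈ v2∈) , v1∈ , v3∈ , inj₁ (v2∈ , v4∉) ,
                                 γ-addEdge≡l sparse H (e1-in v1∈ v2∈) (v1 , v1∈) e1∉ γ≤)
  ... | no v2∉ | yes v4∈ = inj₁ (addEdge H e3 (e3-in v3∈ v4∈) , v1∈ , v3∈ , inj₂ (v2∉ , v4∈) ,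
                                 γ-addEdge≡l sparse H (e3-in v3∈ v4∈) (v1 , v1∈) e3∉ γ≤)
  ... | no v2∉ | no v4∉  = inj₂ (tight⇒alternative₂ l≤2 H tight v2∉ v4∉)
  ... | yes v2∈ | yes v4∈ = contradiction (addEdge-∉ H (e1-in v1∈ v2∈) (e1≢e3 ∘ sym) e3∉)
                                          (γ≡l⇒¬∉ sparse H₁ (e3-in v3∈ v4∈) (v1 , v1∈) γH₁≡l)
    where
    H₁ : Subgraph G
    H₁ = addEdge H e1 (e1-in v1∈ v2∈)
    γH₁≡l : γ H₁ ≡ l
    γH₁≡l = γ-addEdge≡l sparse H (e1-in v1∈ v2∈) (v1 , v1∈) e1∉ γ≤

  private
    I : Graph n (suc (suc k))
    I = identify G v1 v3 v1≢v3

  open LiftIdentify G v1 v3 v1≢v3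
  module D₁ = LiftDelete I e1
  -- quadContract deletes e1 first, after which e3 is numbered punchOut e1≢e3.
  module D₃ = LiftDelete (deleteEdge I e1) (punchOut e1≢e3)

  liftDeletes : Subgraph (quadContract G v1 v3 v1≢v3 e1 e3 e1≢e3) → Subgraph I
  liftDeletes = D₁.liftDelete ∘ D₃.liftDelete

  lift : Subgraph (quadContract G v1 v3 v1≢v3 e1 e3 e1≢e3) → Subgraph G
  lift = liftIdentify ∘ liftDeletes

  γ-liftDeletes : ∀ H′ → γ (liftDeletes H′) ≡ γ H′
  γ-liftDeletes H′ = trans (D₁.γ-liftDelete (D₃.liftDelete H′)) (D₃.γ-liftDelete H′)

  violation⇒tight : ∀ H′ → Nonempty (VS H′) → γ H′ < l → ∃[ H ] Tight H
  violation⇒tight H′ ne γ<l with merged ∈? VS H′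
  ... | no m∉ = contradiction (sparse (lift H′) (liftIdentify-nonempty (liftDeletes H′) ne))
                              (<⇒≱ (subst (_< l) (sym γ-lift) γ<l))
    where
    γ-lift : γ (lift H′) ≡ γ H′
    γ-lift = trans (γ-liftIdentify-∉ (liftDeletes H′) m∉) (γ-liftDeletes H′)
  ... | yes m∈ = lift H′ , a∈liftIdentify (liftDeletes H′) m∈ , b∈liftIdentify (liftDeletes H′) m∈ ,
                 D₁.deleted-∉-liftDelete (D₃.liftDelete H′) , e3∉ , γ≤
    where
    e3∉ : e3 ∉ ES (lift H′)
    e3∉ = subst (_∉ ES (lift H′)) (punchIn-punchOut e1≢e3)
                (D₁.punchIn-∉-liftDelete (D₃.liftDelete H′) (D₃.deleted-∉-liftDelete H′))
    γ-lift : γ (lift H′) ≡ γ H′ + + 1 + + 1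
    γ-lift = trans (γ-liftIdentify-∈ (liftDeletes H′) m∈)
                   (cong (λ x → x + + 1 + + 1) (γ-liftDeletes H′))
    γ≤ : γ (lift H′) ≤ l + + 1
    γ≤ = subst (_≤ l + + 1) (sym γ-lift) (+-monoˡ-≤ (+ 1) (<⇒+1≤ γ<l))

lemma4p4 : ∀ {n k} (l : ℤ) → l ≤ + 2 →
    (G : Graph (suc n) (suc (suc k))) → Sparse l G →
    (v1 v2 v3 v4 : Fin (suc n)) (e1 e2 e3 e4 : Fin (suc (suc k))) →
    Joins G e1 v1 v2 → Joins G e2 v2 v3 → Joins G e3 v3 v4 → Joins G e4 v4 v1 →
    (v1≢v3 : v1 ≢ v3) (e1≢e3 : e1 ≢ e3) →
    ¬ Sparse l (quadContract G v1 v3 v1≢v3 e1 e3 e1≢e3) →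
    (∃[ H ] (v1 ∈ VS H × v3 ∈ VS H
             × ((v2 ∈ VS H × v4 ∉ VS H) ⊎ (v2 ∉ VS H × v4 ∈ VS H))
             × γ {G = G} H ≡ l))
    ⊎ (∃[ K ] (v1 ∈ VS K × v3 ∈ VS K × v2 ∉ VS K × v4 ∉ VS K
               × γ {G = G} K ≡ l + + 1))
lemma4p4 l l≤2 G sparse _ _ _ _ _ _ _ _ e1-joins _ e3-joins _ v1≢v3 e1≢e3 ¬sparse′ =
  let H′ , ne , γ<l = ¬Sparse⇒violation ¬sparse′
      H  , tight    = violation⇒tight H′ ne γ<l
  in  tight⇒conclusion l≤2 H tight
  where open Quadrilateral sparse e1-joins e3-joins v1≢v3 e1≢e3
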